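{- Let $H_1$ and $H_2$ be finite simple graphs with disjoint vertex sets and let $H=H_1\cup H_2$. If $\varepsilon(H_1)$ and $\varepsilon(H_2)$ are both pancyclic, then $\varepsilon(H)$ is pancyclic.
   Context: The union $H_1\cup H_2$ has vertex set $V(H_1)\cup V(H_2)$ and edge set $E(H_1)\cup E(H_2)$. A dominating set of a graph $G$ is a set $D\subseteq V(G)$ such that every vertex of $V(G)\setminus D$ has a neighbour in $D$. The TARS-graph $\varepsilon(G)$ has as vertices the dominating sets of $G$; two distinct dominating sets $X,Y$ are adjacent iff either (i) $Y$ is obtained from $X$ by adding or deleting a single vertex of $G$, or (ii) there are vertices $u\in X$ and $v\in Y\setminus X$ that are adjacent in $G$ with $Y=(X\cup\{v\})\setminus\{u\}$. A graph on $N$ vertices is pancyclic if it contains a cycle of length $\ell$ for every integer $\ell$ with $3\le \ell\le N$. -}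

module Defs where

open import Data.Nat using (ℕ; zero; suc; _+_; _≤_)
open import Data.Fin using (Fin; _↑ˡ_; _↑ʳ_; splitAt)
open import Data.Fin.Subset using (Subset; _∈_; _∉_; _∪_; ⁅_⁆; _-_)
open import Data.Bool using (Bool; true; false)
open import Data.Sum using (_⊎_; inj₁; inj₂)
open import Data.Product using (Σ; ∃; ∃-syntax; _×_; _,_)
open import Data.Vec using (Vec; []; _∷_)
open import Data.List using (List; []; _∷_; map; _++_; length; filter)
open import Relation.Nullary using (¬_)
open import Relation.Unary using (Decidable)
open import Relation.Binary.PropositionalEquality using (_≡_)
open import Function.Definitions using (Injective)

record Graph (n : ℕ) : Set where
  field
    adj   : Fin n → Fin n → Bool
    sym   : ∀ u v → adj u v ≡ adj v u
    irref : ∀ v → adj v v ≡ false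

open Graph public

Adj : ∀ {n} → Graph n → Fin n → Fin n → Set
Adj G u v = adj G u v ≡ true

-- Union of two graphs on disjoint vertex sets: vertex set Fin n₁ ⊎ Fin n₂
-- (encoded as Fin (n₁ + n₂)), edge set the union of the two edge sets.
unionAdj : ∀ {n₁ n₂} → Graph n₁ → Graph n₂ → Fin (n₁ + n₂) → Fin (n₁ + n₂) → Bool
unionAdj {n₁} G₁ G₂ u v with splitAt n₁ u | splitAt n₁ v
... | inj₁ a | inj₁ b = adj G₁ a b
... | inj₂ a | inj₂ b = adj G₂ a b
... | inj₁ _ | inj₂ _ = false
... | inj₂ _ | inj₁ _ = false

unionSym : ∀ {n₁ n₂} (G₁ : Graph n₁) (G₂ : Graph n₂) u v →
           unionAdj G₁ G₂ u v ≡ unionAdj G₁ G₂ v u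
unionSym {n₁} G₁ G₂ u v with splitAt n₁ u | splitAt n₁ v
... | inj₁ a | inj₁ b = sym G₁ a b
... | inj₂ a | inj₂ b = sym G₂ a b
... | inj₁ _ | inj₂ _ = Relation.Binary.PropositionalEquality.refl
... | inj₂ _ | inj₁ _ = Relation.Binary.PropositionalEquality.refl

unionIrref : ∀ {n₁ n₂} (G₁ : Graph n₁) (G₂ : Graph n₂) v → unionAdj G₁ G₂ v v ≡ false
unionIrref {n₁} G₁ G₂ v with splitAt n₁ v
... | inj₁ a = irref G₁ a
... | inj₂ a = irref G₂ a

_∪ᴳ_ : ∀ {n₁ n₂} → Graph n₁ → Graph n₂ → Graph (n₁ + n₂)
G₁ ∪ᴳ G₂ = record { adj = unionAdj G₁ G₂ ; sym = unionSym G₁ G₂ ; irref = unionIrref G₁ G₂ }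

Dominating : ∀ {n} → Graph n → Subset n → Set
Dominating G D = ∀ v → v ∉ D → ∃[ u ] (u ∈ D × Adj G v u)

open import Relation.Nullary using (Dec; yes; no)
open import Data.Fin.Subset.Properties using (_∈?_)
open import Data.Fin.Properties using (all?; any?)
open import Data.Product.Properties using ()
open import Relation.Nullary.Decidable using (_×-dec_; _→-dec_; ¬?)
open import Data.Bool.Properties using () renaming (_≟_ to _≟ᵇ_)

dominating? : ∀ {n} (G : Graph n) → Decidable (Dominating G)
dominating? G D = all? λ v → ¬? (v ∈? D) →-dec any? (λ u → (u ∈? D) ×-dec (adj G v u ≟ᵇ true))

allSubsets : (n : ℕ) → List (Subset n)
allSubsets zero = [] ∷ []
allSubsets (suc n) = map (true ∷_) (allSubsets n) ++ map (false ∷_) (allSubsets n)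

-- Number of dominating sets of G, i.e. the number of vertices of ε(G).
numDom : ∀ {n} → Graph n → ℕ
numDom {n} G = length (filter (dominating? G) (allSubsets n))

TARSAdj : ∀ {n} → Graph n → Subset n → Subset n → Set
TARSAdj G X Y =
    (∃[ v ] (v ∉ X × Y ≡ X ∪ ⁅ v ⁆))
  ⊎ (∃[ v ] (v ∈ X × Y ≡ X - v))
  ⊎ (∃[ u ] ∃[ v ] (u ∈ X × v ∈ Y × v ∉ X × Adj G u v × Y ≡ (X ∪ ⁅ v ⁆) - u))

-- A cycle of length suc k in ε(G): suc k pairwise distinct (injective c)
-- dominating sets c 0, …, c k with c i ~ c (i+1) for i < k, and c k ~ c 0.
open import Data.Fin using (zero; suc; fromℕ; inject₁)

record TARSCycle {n} (G : Graph n) (k : ℕ) : Set where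
  field
    c       : Fin (suc k) → Subset n
    dom     : ∀ i → Dominating G (c i)
    inj     : Injective _≡_ _≡_ c
    step    : ∀ (i : Fin k) → TARSAdj G (c (inject₁ i)) (c (suc i))
    close   : TARSAdj G (c (fromℕ k)) (c zero)

TARSPancyclic : ∀ {n} → Graph n → Set
TARSPancyclic G = ∀ k → 3 ≤ suc k → suc k ≤ numDom G → TARSCycle G k

-- The dominating sets of H₁ ∪ H₂ are exactly the unions X₁ ∪ X₂ of dominating sets of the two
-- parts, and a TARS move inside one part is a TARS move of the union. Hence |ε(H)| = ab with
-- a = |ε(H₁)|, b = |ε(H₂)|, every cycle of ε(H₁) or ε(H₂) lifts to ε(H), and Hamiltonian cycles of
-- ε(H₁) and ε(H₂) span a torus C_a □ C_b inside ε(H). Lifting covers the lengths ℓ ≤ max(a, b).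
-- By Brouwer's theorem a and b are odd, and in the torus of two odd cycles every length a < ℓ ≤ ab
-- is realised by an explicit comb-shaped cycle: odd lengths wind once around C_a, even lengths
-- either do not wind at all or wind once in each direction.

module Submission where

open import Data.Bool using (true; false; not)
open import Data.Bool.Properties using () renaming (_≟_ to _≟ᵇ_)
open import Data.Empty using (⊥-elim)
open import Data.Fin using (Fin; zero; suc; toℕ; _↑ˡ_; _↑ʳ_; splitAt; inject₁; fromℕ; fromℕ<)
open import Data.Fin.Properties
  using (_≟_; any?; toℕ-injective; toℕ-fromℕ; toℕ-fromℕ<; toℕ-inject₁; splitAt-↑ˡ; splitAt-↑ʳ; splitAt⁻¹-↑ˡ; splitAt⁻¹-↑ʳ)
open import Data.Fin.Subset using (Subset; _∈_; _∉_; _⊆_; _∪_; _─_; _-_; ⁅_⁆; ⊥; ⊤; inside; outside; ∣_∣; Empty)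
open import Data.Fin.Subset.Properties
  using (drop-there; ⊆-antisym; x∈⁅x⁆; x∈⁅y⁆⇒x≡y; x∈p∪q⁺; x∈p∪q⁻; p⊆p∪q; p─q⊆p; x∈p∧x≢y⇒x∈p-y; ∪-identityʳ; p─⊥≡p;
         ∈⊤; _⊆?_; _∈?_; s⊆s; out⊆; drop-∷-⊆; ⊥⊆; ∉⊥; Empty-unique; ∣⊥∣≡0; p⊂q⇒∣p∣<∣q∣)
open import Data.List
  using (List; []; _∷_; map; filter; length; cartesianProductWith; applyUpTo; applyDownFrom)
  renaming (_++_ to _++ₗ_; lookup to lookupₗ)
open import Data.List.Properties
  using (map-id; map-cong; map-++; map-∘; length-map; length-++; ++-assoc; ++-identityʳ; length-applyUpTo;
         length-applyDownFrom; filter-++; filter-≐; filter-none; cartesianProductWith-distribʳ-++)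
open import Data.List.Membership.Propositional.Properties using (∈-lookup; ∈-++⁻)
open import Data.List.Relation.Binary.Disjoint.Propositional using (Disjoint)
open import Data.List.Relation.Unary.All as All using (All; []; _∷_)
open import Data.List.Relation.Unary.All.Properties as Allₚ using (map⁺; ++⁺)
open import Data.List.Relation.Unary.AllPairs using ([]; _∷_)
open import Data.List.Relation.Unary.Unique.Propositional using (Unique)
open import Data.List.Relation.Unary.Unique.Propositional.Properties as Unique using ()
open import Data.Nat using (ℕ; zero; suc; pred; _+_; _*_; _∸_; _^_; _≤_; _<_; _≤?_; _<?_; z≤n; s≤s; parity)
open import Data.Nat.DivMod using (_mod_; _%_; _/_; m≡m%n+[m/n]*n; [m+kn]%n≡m%n; m<n⇒m%n≡m; m%n<n; n%n≡0)
open import Data.Nat.ListAction using (sum)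
open import Data.Nat.Properties
  using (≤-refl; ≤-reflexive; ≤-trans; ≤-antisym; <-irrefl; <-≤-trans; ≤-<-trans; <⇒≤; <⇒≢; ≰⇒>; ≮⇒≥; ≤-pred; n≤1+n;
         n≤0⇒n≡0; m≤m+n; m≤n+m; m≤m*n; m≤n⇒∃[o]m+o≡n; +-assoc; +-comm; +-suc; +-identityʳ; *-comm;
         +-cancelˡ-≤; +-cancelʳ-≡; +-mono-≤; +-monoˡ-≤; +-monoʳ-≤; +-monoˡ-<; ∸-monoˡ-≤; m+[n∸m]≡n; m+n∸m≡n;
         +-commutativeSemigroup)
open import Data.Nat.Tactic.RingSolver using (solve-∀)
open import Algebra.Properties.CommutativeSemigroup +-commutativeSemigroup using (x∙yz≈y∙xz)
open import Data.Parity.Base as ℙ using (0ℙ; 1ℙ)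
open import Data.Parity.Properties as ℙ using (+-homo-+; *-homo-*; p+p≡0ℙ)
open import Data.Product using (Σ-syntax; ∃-syntax; _×_; _,_; proj₁; proj₂)
open import Data.Sum using (_⊎_; inj₁; inj₂)
open import Data.Vec using (_∷_; []; _++_; here; there; tabulate)
open import Data.Vec.Properties using (zipWith-++; ++-injectiveˡ; ++-injectiveʳ; lookup∘tabulate; []=⇒lookup; lookup⇒[]=)
open import Function using (_∘_; _⇔_; mk⇔; Equivalence)
open import Level using (0ℓ)
open import Relation.Binary.Construct.Closure.Symmetric using (SymClosure; fwd; bwd)
open import Relation.Binary.PropositionalEquality
  using (_≡_; _≢_; refl; sym; trans; cong; cong₂; subst; subst₂; module ≡-Reasoning)
open import Relation.Nullary using (¬_; Dec; yes; no; does)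
open import Relation.Nullary.Decidable using (_⊎-dec_; _×-dec_; dec-true; dec-false; decidable-stable)
open import Relation.Unary using (Pred; Decidable)

open import Defs hiding (sym)

private
  variable
    m n : ℕ

-- Symmetry of TARS moves

x∈p─q⇒x∉q : ∀ {x : Fin n} (p q : Subset n) → x ∈ p ─ q → x ∉ q
x∈p─q⇒x∉q (_ ∷ p) (outside ∷ q) here       = λ ()
x∈p─q⇒x∉q (_ ∷ p) (_ ∷ q)       (there x∈) = x∈p─q⇒x∉q p q x∈ ∘ drop-there

x∉p-x : ∀ (p : Subset n) x → x ∉ p - x
x∉p-x p x x∈ = x∈p─q⇒x∉q p ⁅ x ⁆ x∈ (x∈⁅x⁆ x)

x∈p∪⁅x⁆ : ∀ (p : Subset n) x → x ∈ p ∪ ⁅ x ⁆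
x∈p∪⁅x⁆ p x = x∈p∪q⁺ (inj₂ (x∈⁅x⁆ x))

x∉p⇒p∪⁅x⁆-x≡p : ∀ {p : Subset n} {x} → x ∉ p → p ∪ ⁅ x ⁆ - x ≡ p
x∉p⇒p∪⁅x⁆-x≡p {p = p} {x} x∉p = ⊆-antisym ⊆p p⊆
  where
  ⊆p : p ∪ ⁅ x ⁆ - x ⊆ p
  ⊆p {y} y∈ with x∈p∪q⁻ p ⁅ x ⁆ (p─q⊆p _ _ y∈)
  ... | inj₁ y∈p  = y∈p
  ... | inj₂ y∈⁅x⁆ = ⊥-elim (x∈p─q⇒x∉q (p ∪ ⁅ x ⁆) ⁅ x ⁆ y∈ y∈⁅x⁆)
  p⊆ : p ⊆ p ∪ ⁅ x ⁆ - x
  p⊆ y∈p = x∈p∧x≢y⇒x∈p-y (p⊆p∪q _ y∈p) λ { refl → x∉p y∈p }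

x∈p⇒[p-x]∪⁅x⁆≡p : ∀ {p : Subset n} {x} → x ∈ p → (p - x) ∪ ⁅ x ⁆ ≡ p
x∈p⇒[p-x]∪⁅x⁆≡p {p = p} {x} x∈p = ⊆-antisym ⊆p p⊆
  where
  ⊆p : (p - x) ∪ ⁅ x ⁆ ⊆ p
  ⊆p {y} y∈ with x∈p∪q⁻ (p - x) ⁅ x ⁆ y∈
  ... | inj₁ y∈p-x = p─q⊆p _ _ y∈p-x
  ... | inj₂ y∈⁅x⁆ = subst (_∈ p) (sym (x∈⁅y⁆⇒x≡y x y∈⁅x⁆)) x∈p
  p⊆ : p ⊆ (p - x) ∪ ⁅ x ⁆
  p⊆ {y} y∈p with y ≟ x
  ... | yes refl = x∈p∪⁅x⁆ (p - x) y
  ... | no y≢x   = x∈p∪q⁺ (inj₁ (x∈p∧x≢y⇒x∈p-y y∈p y≢x))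

TARSAdj-sym : (G : Graph n) → ∀ {X Y} → TARSAdj G X Y → TARSAdj G Y X
TARSAdj-sym G (inj₁ (v , v∉X , refl)) =
  inj₂ (inj₁ (v , x∈p∪⁅x⁆ _ v , sym (x∉p⇒p∪⁅x⁆-x≡p v∉X)))
TARSAdj-sym G (inj₂ (inj₁ (v , v∈X , refl))) =
  inj₁ (v , x∉p-x _ v , sym (x∈p⇒[p-x]∪⁅x⁆≡p v∈X))
TARSAdj-sym G {X} (inj₂ (inj₂ (u , v , u∈X , v∈Y , v∉X , u~v , refl))) =
  inj₂ (inj₂ (v , u , v∈Y , u∈X , x∉p-x _ u , trans (Graph.sym G v u) u~v , X≡))
  where
  X≡ : X ≡ ((X ∪ ⁅ v ⁆ - u) ∪ ⁅ u ⁆) - v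
  X≡ = sym (trans (cong (_- v) (x∈p⇒[p-x]∪⁅x⁆≡p (p⊆p∪q _ u∈X))) (x∉p⇒p∪⁅x⁆-x≡p v∉X))

-- The disjoint union of two graphs

data Split (m n : ℕ) : Fin (m + n) → Set where
  left  : ∀ i → Split m n (i ↑ˡ n)
  right : ∀ i → Split m n (m ↑ʳ i)

split : ∀ m n (j : Fin (m + n)) → Split m n j
split m n j with splitAt m j in eq
... | inj₁ i = subst (Split m n) (splitAt⁻¹-↑ˡ eq) (left i)
... | inj₂ i = subst (Split m n) (splitAt⁻¹-↑ʳ eq) (right i)

∈-++⁺ˡ : ∀ {i : Fin m} {X : Subset m} (Y : Subset n) → i ∈ X → i ↑ˡ n ∈ X ++ Y
∈-++⁺ˡ Y here       = here
∈-++⁺ˡ Y (there i∈) = there (∈-++⁺ˡ Y i∈)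

∈-++⁻ˡ : ∀ {i : Fin m} (X : Subset m) {Y : Subset n} → i ↑ˡ n ∈ X ++ Y → i ∈ X
∈-++⁻ˡ {i = zero}  (_ ∷ X) here       = here
∈-++⁻ˡ {i = suc i} (_ ∷ X) (there i∈) = there (∈-++⁻ˡ X i∈)

∈-++⁺ʳ : ∀ {i : Fin n} (X : Subset m) {Y : Subset n} → i ∈ Y → m ↑ʳ i ∈ X ++ Y
∈-++⁺ʳ []      i∈ = i∈
∈-++⁺ʳ (_ ∷ X) i∈ = there (∈-++⁺ʳ X i∈)

∈-++⁻ʳ : ∀ {i : Fin n} (X : Subset m) {Y : Subset n} → m ↑ʳ i ∈ X ++ Y → i ∈ Y
∈-++⁻ʳ []      i∈         = i∈
∈-++⁻ʳ (_ ∷ X) (there i∈) = ∈-++⁻ʳ X i∈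

⊥++⊥ : ∀ m n → ⊥ {m} ++ ⊥ {n} ≡ ⊥
⊥++⊥ zero    n = refl
⊥++⊥ (suc m) n = cong (outside ∷_) (⊥++⊥ m n)

⁅↑ˡ⁆ : ∀ (i : Fin m) n → ⁅ i ↑ˡ n ⁆ ≡ ⁅ i ⁆ ++ ⊥
⁅↑ˡ⁆ {suc m} zero    n = cong (inside ∷_) (sym (⊥++⊥ m n))
⁅↑ˡ⁆         (suc i) n = cong (outside ∷_) (⁅↑ˡ⁆ i n)

⁅↑ʳ⁆ : ∀ m (i : Fin n) → ⁅ m ↑ʳ i ⁆ ≡ ⊥ ++ ⁅ i ⁆
⁅↑ʳ⁆ zero    i = refl
⁅↑ʳ⁆ (suc m) i = cong (outside ∷_) (⁅↑ʳ⁆ m i)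

module _ (X : Subset m) (Y : Subset n) where

  ++-∪⁅↑ˡ⁆ : ∀ i → (X ++ Y) ∪ ⁅ i ↑ˡ n ⁆ ≡ (X ∪ ⁅ i ⁆) ++ Y
  ++-∪⁅↑ˡ⁆ i = trans (cong ((X ++ Y) ∪_) (⁅↑ˡ⁆ i n))
    (trans (zipWith-++ _ X Y ⁅ i ⁆ ⊥) (cong ((X ∪ ⁅ i ⁆) ++_) (∪-identityʳ Y)))

  ++-─⁅↑ˡ⁆ : ∀ i → (X ++ Y) - (i ↑ˡ n) ≡ (X - i) ++ Y
  ++-─⁅↑ˡ⁆ i = trans (cong ((X ++ Y) ─_) (⁅↑ˡ⁆ i n))
    (trans (zipWith-++ _ X Y ⁅ i ⁆ ⊥) (cong ((X - i) ++_) (p─⊥≡p Y)))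

  ++-∪⁅↑ʳ⁆ : ∀ i → (X ++ Y) ∪ ⁅ m ↑ʳ i ⁆ ≡ X ++ (Y ∪ ⁅ i ⁆)
  ++-∪⁅↑ʳ⁆ i = trans (cong ((X ++ Y) ∪_) (⁅↑ʳ⁆ m i))
    (trans (zipWith-++ _ X Y ⊥ ⁅ i ⁆) (cong (_++ (Y ∪ ⁅ i ⁆)) (∪-identityʳ X)))

  ++-─⁅↑ʳ⁆ : ∀ i → (X ++ Y) - (m ↑ʳ i) ≡ X ++ (Y - i)
  ++-─⁅↑ʳ⁆ i = trans (cong ((X ++ Y) ─_) (⁅↑ʳ⁆ m i))
    (trans (zipWith-++ _ X Y ⊥ ⁅ i ⁆) (cong (_++ (Y - i)) (p─⊥≡p X)))

length-filter-map : ∀ {A B : Set} {P : Pred B 0ℓ} (P? : Decidable P) (g : A → B) xs →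
                    length (filter P? (map g xs)) ≡ length (filter (P? ∘ g) xs)
length-filter-map P? g []       = refl
length-filter-map P? g (x ∷ xs) with does (P? (g x))
... | true  = cong suc (length-filter-map P? g xs)
... | false = length-filter-map P? g xs

module _ {A B C : Set} where

  length-filter-cartesianProductWith :
    ∀ {P : Pred C 0ℓ} {P₁ : Pred A 0ℓ} {P₂ : Pred B 0ℓ} (P? : Decidable P) (P₁? : Decidable P₁) (P₂? : Decidable P₂)
    (f : A → B → C) → (∀ {x y} → P (f x y) ⇔ (P₁ x × P₂ y)) → ∀ xs ys →
    length (filter P? (cartesianProductWith f xs ys)) ≡ length (filter P₁? xs) * length (filter P₂? ys)
  length-filter-cartesianProductWith P? P₁? P₂? f P⇔ [] ys = refl
  length-filter-cartesianProductWith P? P₁? P₂? f P⇔ (x ∷ xs) ys = begin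
    length (filter P? (map (f x) ys ++ₗ cartesianProductWith f xs ys))
      ≡⟨ cong length (filter-++ P? (map (f x) ys) _) ⟩
    length (filter P? (map (f x) ys) ++ₗ filter P? (cartesianProductWith f xs ys))
      ≡⟨ length-++ (filter P? (map (f x) ys)) ⟩
    length (filter P? (map (f x) ys)) + length (filter P? (cartesianProductWith f xs ys))
      ≡⟨ cong₂ _+_ (length-filter-map P? (f x) ys) (length-filter-cartesianProductWith P? P₁? P₂? f P⇔ xs ys) ⟩
    length (filter (P? ∘ f x) ys) + length (filter P₁? xs) * length (filter P₂? ys)
      ≡⟨ row ⟩
    length (filter P₁? (x ∷ xs)) * length (filter P₂? ys) ∎
    where
    open ≡-Reasoning
    row : length (filter (P? ∘ f x) ys) + length (filter P₁? xs) * length (filter P₂? ys)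
          ≡ length (filter P₁? (x ∷ xs)) * length (filter P₂? ys)
    row with P₁? x
    ... | yes p₁ = cong (λ l → length l + _)
                        (filter-≐ (P? ∘ f x) P₂? (proj₂ ∘ Equivalence.to P⇔ , λ q → Equivalence.from P⇔ (p₁ , q)) ys)
    ... | no ¬p₁ = cong (λ l → length l + _)
                        (filter-none (P? ∘ f x) (All.universal (λ _ → ¬p₁ ∘ proj₁ ∘ Equivalence.to P⇔) ys))

map-∷-cartesianProductWith : ∀ s (Xs : List (Subset m)) (Ys : List (Subset n)) →
  map (s ∷_) (cartesianProductWith _++_ Xs Ys) ≡ cartesianProductWith _++_ (map (s ∷_) Xs) Ys
map-∷-cartesianProductWith s []       Ys = refl
map-∷-cartesianProductWith s (X ∷ Xs) Ys = trans (map-++ (s ∷_) (map (X ++_) Ys) _)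
  (cong₂ _++ₗ_ (sym (map-∘ Ys)) (map-∷-cartesianProductWith s Xs Ys))

allSubsets-+ : ∀ m n → allSubsets (m + n) ≡ cartesianProductWith _++_ (allSubsets m) (allSubsets n)
allSubsets-+ zero    n = sym (trans (++-identityʳ _) (map-id (allSubsets n)))
allSubsets-+ (suc m) n = begin
  map (true ∷_) (allSubsets (m + n)) ++ₗ map (false ∷_) (allSubsets (m + n))
    ≡⟨ cong (λ S → map (true ∷_) S ++ₗ map (false ∷_) S) (allSubsets-+ m n) ⟩
  map (true ∷_) (prod (allSubsets m)) ++ₗ map (false ∷_) (prod (allSubsets m))
    ≡⟨ cong₂ _++ₗ_ (map-∷-cartesianProductWith true (allSubsets m) (allSubsets n))
                   (map-∷-cartesianProductWith false (allSubsets m) (allSubsets n)) ⟩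
  prod (map (true ∷_) (allSubsets m)) ++ₗ prod (map (false ∷_) (allSubsets m))
    ≡⟨ sym (cartesianProductWith-distribʳ-++ _++_ (map (true ∷_) (allSubsets m)) _ (allSubsets n)) ⟩
  prod (allSubsets (suc m)) ∎
  where
  open ≡-Reasoning
  prod : ∀ {k} → List (Subset k) → List (Subset (k + n))
  prod Xs = cartesianProductWith _++_ Xs (allSubsets n)

module Union {n₁ n₂} (G₁ : Graph n₁) (G₂ : Graph n₂) where

  H : Graph (n₁ + n₂)
  H = G₁ ∪ᴳ G₂

  adj-↑ˡ : ∀ u v → adj H (u ↑ˡ n₂) (v ↑ˡ n₂) ≡ adj G₁ u v
  adj-↑ˡ u v rewrite splitAt-↑ˡ n₁ u n₂ | splitAt-↑ˡ n₁ v n₂ = refl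

  adj-↑ʳ : ∀ u v → adj H (n₁ ↑ʳ u) (n₁ ↑ʳ v) ≡ adj G₂ u v
  adj-↑ʳ u v rewrite splitAt-↑ʳ n₁ n₂ u | splitAt-↑ʳ n₁ n₂ v = refl

  adj-↑ˡ↑ʳ : ∀ u v → adj H (u ↑ˡ n₂) (n₁ ↑ʳ v) ≡ false
  adj-↑ˡ↑ʳ u v rewrite splitAt-↑ˡ n₁ u n₂ | splitAt-↑ʳ n₁ n₂ v = refl

  adj-↑ʳ↑ˡ : ∀ u v → adj H (n₁ ↑ʳ u) (v ↑ˡ n₂) ≡ false
  adj-↑ʳ↑ˡ u v rewrite splitAt-↑ʳ n₁ n₂ u | splitAt-↑ˡ n₁ v n₂ = refl

  TARSAdj-++ˡ : ∀ {X X′} (Y : Subset n₂) → TARSAdj G₁ X X′ → TARSAdj H (X ++ Y) (X′ ++ Y)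
  TARSAdj-++ˡ {X} Y (inj₁ (v , v∉X , refl)) =
    inj₁ (v ↑ˡ n₂ , v∉X ∘ ∈-++⁻ˡ X , sym (++-∪⁅↑ˡ⁆ X Y v))
  TARSAdj-++ˡ {X} Y (inj₂ (inj₁ (v , v∈X , refl))) =
    inj₂ (inj₁ (v ↑ˡ n₂ , ∈-++⁺ˡ Y v∈X , sym (++-─⁅↑ˡ⁆ X Y v)))
  TARSAdj-++ˡ {X} Y (inj₂ (inj₂ (u , v , u∈X , v∈X′ , v∉X , u~v , refl))) =
    inj₂ (inj₂ (u ↑ˡ n₂ , v ↑ˡ n₂ , ∈-++⁺ˡ Y u∈X , ∈-++⁺ˡ Y v∈X′ , v∉X ∘ ∈-++⁻ˡ X ,
                trans (adj-↑ˡ u v) u~v ,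
                trans (sym (++-─⁅↑ˡ⁆ (X ∪ ⁅ v ⁆) Y u)) (cong (_- (u ↑ˡ n₂)) (sym (++-∪⁅↑ˡ⁆ X Y v)))))

  TARSAdj-++ʳ : ∀ (X : Subset n₁) {Y Y′} → TARSAdj G₂ Y Y′ → TARSAdj H (X ++ Y) (X ++ Y′)
  TARSAdj-++ʳ X {Y} (inj₁ (v , v∉Y , refl)) =
    inj₁ (n₁ ↑ʳ v , v∉Y ∘ ∈-++⁻ʳ X , sym (++-∪⁅↑ʳ⁆ X Y v))
  TARSAdj-++ʳ X {Y} (inj₂ (inj₁ (v , v∈Y , refl))) =
    inj₂ (inj₁ (n₁ ↑ʳ v , ∈-++⁺ʳ X v∈Y , sym (++-─⁅↑ʳ⁆ X Y v)))
  TARSAdj-++ʳ X {Y} (inj₂ (inj₂ (u , v , u∈Y , v∈Y′ , v∉Y , u~v , refl))) =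
    inj₂ (inj₂ (n₁ ↑ʳ u , n₁ ↑ʳ v , ∈-++⁺ʳ X u∈Y , ∈-++⁺ʳ X v∈Y′ , v∉Y ∘ ∈-++⁻ʳ X ,
                trans (adj-↑ʳ u v) u~v ,
                trans (sym (++-─⁅↑ʳ⁆ X (Y ∪ ⁅ v ⁆) u)) (cong (_- (n₁ ↑ʳ u)) (sym (++-∪⁅↑ʳ⁆ X Y v)))))

  Dominating-++⁺ : ∀ {X Y} → Dominating G₁ X → Dominating G₂ Y → Dominating H (X ++ Y)
  Dominating-++⁺ {X} {Y} domX domY j j∉ with split n₁ n₂ j
  ... | left i with domX i (j∉ ∘ ∈-++⁺ˡ Y)
  ...   | u , u∈X , i~u = u ↑ˡ n₂ , ∈-++⁺ˡ Y u∈X , trans (adj-↑ˡ i u) i~u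
  Dominating-++⁺ {X} {Y} domX domY j j∉ | right i with domY i (j∉ ∘ ∈-++⁺ʳ X)
  ...   | u , u∈Y , i~u = n₁ ↑ʳ u , ∈-++⁺ʳ X u∈Y , trans (adj-↑ʳ i u) i~u

  Dominating-++⁻ˡ : ∀ {X Y} → Dominating H (X ++ Y) → Dominating G₁ X
  Dominating-++⁻ˡ {X} dom i i∉ with dom (i ↑ˡ n₂) (i∉ ∘ ∈-++⁻ˡ X)
  ... | u , u∈ , i~u with split n₁ n₂ u
  ...   | left w  = w , ∈-++⁻ˡ X u∈ , trans (sym (adj-↑ˡ i w)) i~u
  ...   | right w with trans (sym (adj-↑ˡ↑ʳ i w)) i~u
  ...     | ()

  Dominating-++⁻ʳ : ∀ {X Y} → Dominating H (X ++ Y) → Dominating G₂ Y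
  Dominating-++⁻ʳ {X} dom i i∉ with dom (n₁ ↑ʳ i) (i∉ ∘ ∈-++⁻ʳ X)
  ... | u , u∈ , i~u with split n₁ n₂ u
  ...   | right w = w , ∈-++⁻ʳ X u∈ , trans (sym (adj-↑ʳ i w)) i~u
  ...   | left w with trans (sym (adj-↑ʳ↑ˡ i w)) i~u
  ...     | ()

  Dominating-++ : ∀ {X Y} → Dominating H (X ++ Y) ⇔ (Dominating G₁ X × Dominating G₂ Y)
  Dominating-++ = mk⇔ (λ d → Dominating-++⁻ˡ d , Dominating-++⁻ʳ d) (λ (d₁ , d₂) → Dominating-++⁺ d₁ d₂)

  numDom-∪ᴳ : numDom H ≡ numDom G₁ * numDom G₂
  numDom-∪ᴳ = trans (cong (length ∘ filter (dominating? H)) (allSubsets-+ n₁ n₂))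
    (length-filter-cartesianProductWith (dominating? H) (dominating? G₁) (dominating? G₂) _++_ Dominating-++
      (allSubsets n₁) (allSubsets n₂))

-- Brouwer's theorem: every graph has an odd number of dominating sets

parity-+-double : ∀ m n → parity (m + (m + n)) ≡ parity n
parity-+-double m n = begin
  parity (m + (m + n))                    ≡⟨ +-homo-+ m (m + n) ⟩
  parity m ℙ.+ parity (m + n)             ≡⟨ cong (parity m ℙ.+_) (+-homo-+ m n) ⟩
  parity m ℙ.+ (parity m ℙ.+ parity n)    ≡⟨ sym (ℙ.+-assoc (parity m) _ _) ⟩
  (parity m ℙ.+ parity m) ℙ.+ parity n    ≡⟨ cong (ℙ._+ parity n) (p+p≡0ℙ (parity m)) ⟩
  parity n                                ∎
  where open ≡-Reasoning

module _ {A : Set} where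

  parity-sum-count : ∀ {P : Pred A 0ℓ} (P? : Decidable P) (f : A → ℕ) →
    (∀ x → parity (f x) ≡ 1ℙ ⇔ P x) → ∀ xs → parity (sum (map f xs)) ≡ parity (length (filter P? xs))
  parity-sum-count P? f odd⇔P []       = refl
  parity-sum-count P? f odd⇔P (x ∷ xs) with P? x
  ... | yes px = begin
    parity (f x + sum (map f xs))                ≡⟨ +-homo-+ (f x) _ ⟩
    parity (f x) ℙ.+ parity (sum (map f xs))     ≡⟨ cong₂ ℙ._+_ (Equivalence.from (odd⇔P x) px) IH ⟩
    1ℙ ℙ.+ parity (length (filter P? xs))        ≡⟨ sym (+-homo-+ 1 (length (filter P? xs))) ⟩
    parity (suc (length (filter P? xs)))         ∎
    where
    open ≡-Reasoning
    IH = parity-sum-count P? f odd⇔P xs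
  ... | no ¬px = trans (+-homo-+ (f x) _) (cong₂ ℙ._+_ even (parity-sum-count P? f odd⇔P xs))
    where
    even : parity (f x) ≡ 0ℙ
    even with parity (f x) in eq
    ... | 0ℙ = refl
    ... | 1ℙ = ⊥-elim (¬px (Equivalence.to (odd⇔P x) eq))

  -- A symmetric relation is counted twice off the diagonal.
  parity-double-count : ∀ {R : A → A → Set} (R? : ∀ x y → Dec (R x y)) → (∀ {x y} → R x y → R y x) → ∀ xs →
    parity (sum (map (λ x → length (filter (R? x) xs)) xs)) ≡ parity (length (filter (λ x → R? x x) xs))
  parity-double-count R? R-sym []      = refl
  parity-double-count R? R-sym (z ∷ L) = begin
    parity (length (filter (R? z) (z ∷ L)) + F L (z ∷ L))
      ≡⟨ cong (λ m → parity (length (filter (R? z) (z ∷ L)) + m)) (trans (column L) (cong (_+ F L L) swap)) ⟩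
    parity (length (filter (R? z) (z ∷ L)) + (c + F L L))
      ≡⟨ diagonal ⟩
    parity (length (filter (λ x → R? x x) (z ∷ L))) ∎
    where
    open ≡-Reasoning
    F : List A → List A → ℕ
    F L M = sum (map (λ x → length (filter (R? x) M)) L)
    c = length (filter (R? z) L)
    IH = parity-double-count R? R-sym L

    column : ∀ L {M} → F L (z ∷ M) ≡ length (filter (λ x → R? x z) L) + F L M
    shift : ∀ x L {M} → length (filter (R? x) M) + F L (z ∷ M)
                        ≡ length (filter (λ y → R? y z) L) + (length (filter (R? x) M) + F L M)
    column []            = refl
    column (x ∷ L) {M} with R? x z
    ... | yes _ = cong suc (shift x L)
    ... | no _  = shift x L
    shift x L {M} = trans (cong (length (filter (R? x) M) +_) (column L))
                          (x∙yz≈y∙xz (length (filter (R? x) M)) (length (filter (λ y → R? y z) L)) (F L M))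
    swap : length (filter (λ x → R? x z) L) ≡ c
    swap = cong length (filter-≐ (λ x → R? x z) (R? z) (R-sym , R-sym) L)
    diagonal : parity (length (filter (R? z) (z ∷ L)) + (c + F L L)) ≡ parity (length (filter (λ x → R? x x) (z ∷ L)))
    diagonal with R? z z
    ... | yes _ = begin
      parity (1 + (c + (c + F L L)))     ≡⟨ +-homo-+ 1 (c + (c + F L L)) ⟩
      1ℙ ℙ.+ parity (c + (c + F L L))    ≡⟨ cong (1ℙ ℙ.+_) (trans (parity-+-double c (F L L)) IH) ⟩
      1ℙ ℙ.+ parity (length (filter (λ x → R? x x) L))  ≡⟨ sym (+-homo-+ 1 (length (filter (λ x → R? x x) L))) ⟩
      parity (1 + length (filter (λ x → R? x x) L))      ∎
    ... | no _  = trans (parity-+-double c (F L L)) IH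

length-filter-allSubsets : ∀ {P : Pred (Subset (suc n)) 0ℓ} (P? : Decidable P) →
  length (filter P? (allSubsets (suc n)))
    ≡ length (filter (P? ∘ (inside ∷_)) (allSubsets n)) + length (filter (P? ∘ (outside ∷_)) (allSubsets n))
length-filter-allSubsets {n} P? = begin
  length (filter P? (map (inside ∷_) S ++ₗ map (outside ∷_) S))
    ≡⟨ cong length (filter-++ P? (map (inside ∷_) S) _) ⟩
  length (filter P? (map (inside ∷_) S) ++ₗ filter P? (map (outside ∷_) S))
    ≡⟨ length-++ (filter P? (map (inside ∷_) S)) ⟩
  length (filter P? (map (inside ∷_) S)) + length (filter P? (map (outside ∷_) S))
    ≡⟨ cong₂ _+_ (length-filter-map P? (inside ∷_) S) (length-filter-map P? (outside ∷_) S) ⟩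
  length (filter (P? ∘ (inside ∷_)) S) + length (filter (P? ∘ (outside ∷_)) S) ∎
  where
  open ≡-Reasoning
  S = allSubsets n

length-filter-⊆ : ∀ (C : Subset n) → length (filter (_⊆? C) (allSubsets n)) ≡ 2 ^ ∣ C ∣
length-filter-⊆ []            = refl
length-filter-⊆ {suc n} (inside ∷ C)  = trans (length-filter-allSubsets (_⊆? inside ∷ C))
  (trans (cong₂ _+_ (tail⊆C s⊆s) (tail⊆C out⊆)) (cong (2 ^ ∣ C ∣ +_) (sym (+-identityʳ _))))
  where
  tail⊆C : ∀ {s} → (∀ {Y} → Y ⊆ C → s ∷ Y ⊆ inside ∷ C) →
             length (filter (λ Y → s ∷ Y ⊆? inside ∷ C) (allSubsets n)) ≡ 2 ^ ∣ C ∣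
  tail⊆C ⊆⁺ = trans (cong length (filter-≐ _ (_⊆? C) (drop-∷-⊆ , ⊆⁺) (allSubsets n))) (length-filter-⊆ C)
length-filter-⊆ {suc n} (outside ∷ C) = trans (length-filter-allSubsets (_⊆? outside ∷ C))
  (cong₂ _+_ (cong length (filter-none (λ Y → inside ∷ Y ⊆? outside ∷ C)
                                       (All.universal (λ _ → inside∷⊈outside∷) (allSubsets n))))
             (trans (cong length (filter-≐ _ (_⊆? C) (drop-∷-⊆ , out⊆) (allSubsets n))) (length-filter-⊆ C)))
  where
  inside∷⊈outside∷ : ∀ {Y} → ¬ (inside ∷ Y ⊆ outside ∷ C)
  inside∷⊈outside∷ ⊆C with ⊆C here
  ... | ()

parity-2^ : ∀ m → parity (2 ^ m) ≡ 1ℙ ⇔ m ≡ 0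
parity-2^ m = mk⇔ (to m) (cong (λ k → parity (2 ^ k)))
  where
  to : ∀ m → parity (2 ^ m) ≡ 1ℙ → m ≡ 0
  to zero    _   = refl
  to (suc m) odd with trans (sym (*-homo-* 2 (2 ^ m))) odd
  ... | ()

∣p∣≡0⇔Empty : ∀ {p : Subset n} → ∣ p ∣ ≡ 0 ⇔ Empty p
∣p∣≡0⇔Empty {n} {p} = mk⇔ to (λ empty → trans (cong ∣_∣ (Empty-unique empty)) (∣⊥∣≡0 n))
  where
  to : ∣ p ∣ ≡ 0 → Empty p
  to ∣p∣≡0 (x , x∈p) = <-irrefl (sym ∣p∣≡0) (subst₂ _<_ (∣⊥∣≡0 n) refl (p⊂q⇒∣p∣<∣q∣ (⊥⊆ , x , x∈p , ∉⊥)))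

module Brouwer (G : Graph n) where

  Near : Subset n → Fin n → Set
  Near X y = y ∈ X ⊎ ∃[ x ] (x ∈ X × Adj G y x)

  near? : ∀ X y → Dec (Near X y)
  near? X y = (y ∈? X) ⊎-dec any? λ x → (x ∈? X) ×-dec (adj G y x ≟ᵇ true)

  undominated : Subset n → Subset n
  undominated X = tabulate λ y → not (does (near? X y))

  ∈-undominated : ∀ {X y} → y ∈ undominated X ⇔ (¬ Near X y)
  ∈-undominated {X} {y} = mk⇔ to from
    where
    to : y ∈ undominated X → ¬ Near X y
    to y∈ near with trans (cong not (sym (dec-true (near? X y) near)))
                          (trans (sym (lookup∘tabulate _ y)) ([]=⇒lookup y∈))
    ... | ()
    from : ¬ Near X y → y ∈ undominated X
    from ¬near = lookup⇒[]= y _ (trans (lookup∘tabulate _ y) (cong not (dec-false (near? X y) ¬near)))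

  undominated-sym : ∀ {X Y} → Y ⊆ undominated X → X ⊆ undominated Y
  undominated-sym {Y = Y} Y⊆ {x} x∈X = Equivalence.from ∈-undominated near-Y
    where
    near-Y : ¬ Near Y x
    near-Y (inj₁ x∈Y)            = Equivalence.to ∈-undominated (Y⊆ x∈Y) (inj₁ x∈X)
    near-Y (inj₂ (y , y∈Y , x~y)) = Equivalence.to ∈-undominated (Y⊆ y∈Y) (inj₂ (x , x∈X , trans (Graph.sym G y x) x~y))

  ⊆undominated-self : ∀ {X} → X ⊆ undominated X ⇔ X ⊆ ⊥
  ⊆undominated-self = mk⇔ (λ X⊆ {_} x∈X → ⊥-elim (Equivalence.to ∈-undominated (X⊆ x∈X) (inj₁ x∈X)))
                          (λ X⊆⊥ {_} x∈X → ⊥-elim (∉⊥ (X⊆⊥ x∈X)))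

  Empty-undominated⇔Dominating : ∀ {X} → Empty (undominated X) ⇔ Dominating G X
  Empty-undominated⇔Dominating {X} = mk⇔ to from
    where
    to : Empty (undominated X) → Dominating G X
    to empty v v∉X with decidable-stable (near? X v) (λ ¬near → empty (v , Equivalence.from ∈-undominated ¬near))
    ... | inj₁ v∈X = ⊥-elim (v∉X v∈X)
    ... | inj₂ nbr = nbr
    from : Dominating G X → Empty (undominated X)
    from dom (y , y∈) with y ∈? X
    ... | yes y∈X = Equivalence.to ∈-undominated y∈ (inj₁ y∈X)
    ... | no y∉X  = Equivalence.to ∈-undominated y∈ (inj₂ (dom y y∉X))

  odd-2^∣undominated∣⇔Dominating : ∀ X → parity (2 ^ ∣ undominated X ∣) ≡ 1ℙ ⇔ Dominating G X
  odd-2^∣undominated∣⇔Dominating X = mk⇔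
    (Equivalence.to Empty-undominated⇔Dominating ∘ Equivalence.to ∣p∣≡0⇔Empty ∘ Equivalence.to (parity-2^ _))
    (Equivalence.from (parity-2^ _) ∘ Equivalence.from ∣p∣≡0⇔Empty ∘ Equivalence.from Empty-undominated⇔Dominating)

  -- Count the pairs (X , Y) with Y ⊆ undominated X. For fixed X there are 2 ^ ∣ undominated X ∣,
  -- an odd number exactly when X dominates; the relation is symmetric, and on the diagonal it holds
  -- for X = ∅ only.
  numDom-odd : parity (numDom G) ≡ 1ℙ
  numDom-odd = begin
    parity (length (filter (dominating? G) S))
      ≡⟨ sym (parity-sum-count (dominating? G) (λ X → 2 ^ ∣ undominated X ∣) odd-2^∣undominated∣⇔Dominating S) ⟩
    parity (sum (map (λ X → 2 ^ ∣ undominated X ∣) S))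
      ≡⟨ cong (parity ∘ sum) (map-cong (λ X → sym (length-filter-⊆ (undominated X))) S) ⟩
    parity (sum (map (λ X → length (filter (_⊆? undominated X) S)) S))
      ≡⟨ parity-double-count (λ X Y → Y ⊆? undominated X) undominated-sym S ⟩
    parity (length (filter (λ X → X ⊆? undominated X) S))
      ≡⟨ cong (parity ∘ length)
              (filter-≐ _ (_⊆? ⊥) (Equivalence.to ⊆undominated-self , Equivalence.from ⊆undominated-self) S) ⟩
    parity (length (filter (_⊆? ⊥) S))
      ≡⟨ cong parity (length-filter-⊆ (⊥ {n})) ⟩
    parity (2 ^ ∣ ⊥ {n} ∣)
      ≡⟨ cong (λ m → parity (2 ^ m)) (∣⊥∣≡0 n) ⟩
    1ℙ ∎
    where
    open ≡-Reasoning
    S = allSubsets n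

even-or-odd : ∀ n → ∃[ m ] (n ≡ m + m ⊎ n ≡ suc (m + m))
even-or-odd zero    = 0 , inj₁ refl
even-or-odd (suc n) with even-or-odd n
... | m , inj₁ refl = m , inj₂ refl
... | m , inj₂ refl = suc m , inj₁ (cong suc (sym (+-suc m m)))

odd-witness : ∀ {n} → parity n ≡ 1ℙ → ∃[ m ] n ≡ suc (m + m)
odd-witness {n} odd with even-or-odd n
... | m , inj₂ n≡ = m , n≡
... | m , inj₁ refl with trans (sym (trans (+-homo-+ m m) (p+p≡0ℙ (parity m)))) odd
...   | ()

-- Walks and cycles

module _ {A : Set} where

  infixr 5 _◅_

  data Walk (R : A → A → Set) : A → A → List A → Set where
    [_] : ∀ x → Walk R x x (x ∷ [])
    _◅_ : ∀ {x y z ys} → R x y → Walk R y z (y ∷ ys) → Walk R x z (x ∷ y ∷ ys)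

  module _ {R : A → A → Set} where

    Walk-++ : ∀ {x y z w xs ys} → Walk R x y xs → R y z → Walk R z w ys → Walk R x w (xs ++ₗ ys)
    Walk-++ [ x ]    r w′@([ _ ]) = r ◅ w′
    Walk-++ [ x ]    r w′@(_ ◅ _) = r ◅ w′
    Walk-++ (r′ ◅ w) r w′         = r′ ◅ Walk-++ w r w′

    Walk-step : ∀ {x y xs} → Walk R x y (x ∷ xs) → ∀ i → R (lookupₗ (x ∷ xs) (inject₁ i)) (lookupₗ xs i)
    Walk-step (r ◅ _)       zero    = r
    Walk-step (_ ◅ w@(_ ◅ _)) (suc i) = Walk-step w i

    Walk-last : ∀ {x y xs} → Walk R x y (x ∷ xs) → lookupₗ (x ∷ xs) (fromℕ (length xs)) ≡ y
    Walk-last [ x ]   = refl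
    Walk-last (_ ◅ w) = Walk-last w

  Unique-lookup-injective : ∀ {xs : List A} → Unique xs → ∀ i j → lookupₗ xs i ≡ lookupₗ xs j → i ≡ j
  Unique-lookup-injective (x∉ ∷ u) zero    zero    _ = refl
  Unique-lookup-injective (x∉ ∷ u) zero    (suc j) x≡ = ⊥-elim (All.lookup x∉ (∈-lookup j) x≡)
  Unique-lookup-injective (x∉ ∷ u) (suc i) zero    ≡x = ⊥-elim (All.lookup x∉ (∈-lookup i) (sym ≡x))
  Unique-lookup-injective (x∉ ∷ u) (suc i) (suc j) eq = cong suc (Unique-lookup-injective u i j eq)

  record Cycle (R : A → A → Set) (ℓ : ℕ) : Set where
    field
      start end : A
      vertices  : List A
      walk      : Walk R start end vertices
      closing   : R end start
      unique    : Unique vertices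
      length≡   : length vertices ≡ ℓ

module _ {A B : Set} {R : A → A → Set} {S : B → B → Set} (f : A → B) (f-hom : ∀ {x y} → R x y → S (f x) (f y)) where

  Walk-map : ∀ {x y xs} → Walk R x y xs → Walk S (f x) (f y) (map f xs)
  Walk-map [ x ]   = [ f x ]
  Walk-map (r ◅ w) = f-hom r ◅ Walk-map w

  module _ {D : A → Set} (f-injective : ∀ {x y} → D x → D y → f x ≡ f y → x ≡ y) where

    Unique-map⁺ : ∀ {xs} → All D xs → Unique xs → Unique (map f xs)
    Unique-map⁺ []         []         = []
    Unique-map⁺ (dx ∷ dxs) (x∉ ∷ u) =
      map⁺ (All.zipWith (λ (x≢y , dy) fx≡fy → x≢y (f-injective dx dy fx≡fy)) (x∉ , dxs)) ∷ Unique-map⁺ dxs u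

    Cycle-map : ∀ {ℓ} (C : Cycle R ℓ) → All D (Cycle.vertices C) → Cycle S ℓ
    Cycle-map C D-vertices = record
      { start    = f start
      ; end      = f end
      ; vertices = map f vertices
      ; walk     = Walk-map walk
      ; closing  = f-hom closing
      ; unique   = Unique-map⁺ D-vertices unique
      ; length≡  = trans (length-map f vertices) length≡
      }
      where open Cycle C

module _ {n} (G : Graph n) where

  Walk→TARSCycle : ∀ {X Y Xs} → Walk (TARSAdj G) X Y (X ∷ Xs) → TARSAdj G Y X → Unique (X ∷ Xs) →
                   All (Dominating G) (X ∷ Xs) → TARSCycle G (length Xs)
  Walk→TARSCycle {X} {Xs = Xs} walk closing unique dominating = record
    { c     = lookupₗ (X ∷ Xs)
    ; dom   = λ i → All.lookup dominating (∈-lookup i)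
    ; inj   = Unique-lookup-injective unique _ _
    ; step  = Walk-step walk
    ; close = subst (λ Y → TARSAdj G Y X) (sym (Walk-last walk)) closing
    }

  Cycle→TARSCycle : ∀ {k} (C : Cycle (TARSAdj G) (suc k)) → All (Dominating G) (Cycle.vertices C) → TARSCycle G k
  Cycle→TARSCycle C dominating = subst (TARSCycle G) (cong pred length≡) (from-walk walk unique dominating)
    where
    open Cycle C
    from-walk : ∀ {Xs} → Walk (TARSAdj G) start end Xs → Unique Xs → All (Dominating G) Xs →
                TARSCycle G (pred (length Xs))
    from-walk w@([ _ ]) = Walk→TARSCycle w closing
    from-walk w@(_ ◅ _) = Walk→TARSCycle w closing

module _ {A : Set} {R : A → A → Set} where

  applyUpTo-walk : ∀ (f : ℕ → A) → (∀ i → R (f i) (f (suc i))) → ∀ n → Walk R (f 0) (f n) (applyUpTo f (suc n))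
  applyUpTo-walk f step zero    = [ f 0 ]
  applyUpTo-walk f step (suc n) = step 0 ◅ applyUpTo-walk (f ∘ suc) (step ∘ suc) n

  applyDownFrom-walk : ∀ (f : ℕ → A) → (∀ i → R (f (suc i)) (f i)) → ∀ n →
                       Walk R (f n) (f 0) (applyDownFrom f (suc n))
  applyDownFrom-walk f step zero    = [ f 0 ]
  applyDownFrom-walk f step (suc n) = step n ◅ applyDownFrom-walk f step n

module _ {A : Set} {f : ℕ → A} (f-injective : ∀ {i j} → f i ≡ f j → i ≡ j) where

  applyUpTo-unique : ∀ n → Unique (applyUpTo f n)
  applyUpTo-unique n = Unique.applyUpTo⁺₁ f n λ i<j _ → <⇒≢ i<j ∘ f-injective

  applyDownFrom-unique : ∀ n → Unique (applyDownFrom f n)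
  applyDownFrom-unique n = Unique.applyDownFrom⁺₁ f n λ j<i _ → <⇒≢ j<i ∘ sym ∘ f-injective

module _ {A : Set} where

  All-disjoint : ∀ {P Q : A → Set} {xs ys} → (∀ {x} → P x → ¬ Q x) → All P xs → All Q ys → Disjoint xs ys
  All-disjoint apart Pxs Qys (x∈xs , x∈ys) = apart (All.lookup Pxs x∈xs) (All.lookup Qys x∈ys)

  Disjoint-++ʳ : ∀ {xs ys zs : List A} → Disjoint xs ys → Disjoint xs zs → Disjoint xs (ys ++ₗ zs)
  Disjoint-++ʳ {ys = ys} xs#ys xs#zs (x∈xs , x∈ys++zs) with ∈-++⁻ ys x∈ys++zs
  ... | inj₁ x∈ys = xs#ys (x∈xs , x∈ys)
  ... | inj₂ x∈zs = xs#zs (x∈xs , x∈zs)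

-- Cycles in the torus C_a □ C_b

Point : Set
Point = ℕ × ℕ

data Move (a b : ℕ) : Point → Point → Set where
  right : ∀ {x y} → Move a b (x , y) (suc x , y)
  up    : ∀ {x y} → Move a b (x , y) (x , suc y)
  wrapʳ : ∀ {x y} → suc x ≡ a → Move a b (x , y) (0 , y)
  wrapᵘ : ∀ {x y} → suc y ≡ b → Move a b (x , y) (x , 0)

Torus : ℕ → ℕ → Point → Point → Set
Torus a b = SymClosure (Move a b)

Cols Rows : ℕ → ℕ → Point → Set
Cols x₀ x₁ p = x₀ ≤ proj₁ p × proj₁ p < x₁
Rows y₀ y₁ p = y₀ ≤ proj₂ p × proj₂ p < y₁

Box : ℕ → ℕ → ℕ → ℕ → Point → Set
Box x₀ x₁ y₀ y₁ p = Cols x₀ x₁ p × Rows y₀ y₁ p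

InGrid : ℕ → ℕ → Point → Set
InGrid a b = Box 0 a 0 b

module _ {lo hi lo′ hi′ : ℕ} where

  Range-apart : ∀ {z} → hi ≤ lo′ → lo ≤ z × z < hi → ¬ (lo′ ≤ z × z < hi′)
  Range-apart hi≤lo′ (_ , z<hi) (lo′≤z , _) = <-irrefl refl (<-≤-trans z<hi (≤-trans hi≤lo′ lo′≤z))

  Range-mono : ∀ {z} → lo′ ≤ lo → hi ≤ hi′ → lo ≤ z × z < hi → lo′ ≤ z × z < hi′
  Range-mono lo′≤lo hi≤hi′ (lo≤z , z<hi) = ≤-trans lo′≤lo lo≤z , <-≤-trans z<hi hi≤hi′

Box⇒InGrid : ∀ {a b x₀ x₁ y₀ y₁} → x₁ ≤ a → y₁ ≤ b → ∀ {p} → Box x₀ x₁ y₀ y₁ p → InGrid a b p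
Box⇒InGrid x₁≤a y₁≤b (cols , rows) = Range-mono z≤n x₁≤a cols , Range-mono z≤n y₁≤b rows

rightward : ℕ → ℕ → ℕ → List Point
rightward x n y = applyUpTo (λ i → (i + x , y)) (suc n)

leftward : ℕ → ℕ → ℕ → List Point
leftward x n y = applyDownFrom (λ i → (i + x , y)) (suc n)

downward : ℕ → ℕ → List Point
downward x n = applyDownFrom (λ i → (x , i)) (suc n)

above : ℕ → ℕ → ℕ → List Point
above x y zero    = []
above x y (suc v) = (x , suc y) ∷ above x (suc y) v

teeth : ℕ → ℕ → List ℕ → List Point
teeth x y []       = []
teeth x y (e ∷ es) = rightward x e y ++ₗ leftward x e (suc y) ++ₗ teeth x (2 + y) es

module _ {x y : ℕ} where

  rightward-unique : ∀ n → Unique (rightward x n y)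
  rightward-unique n = applyUpTo-unique {f = λ i → (i + x , y)} (λ eq → +-cancelʳ-≡ x _ _ (cong proj₁ eq)) (suc n)

  leftward-unique : ∀ n → Unique (leftward x n y)
  leftward-unique n = applyDownFrom-unique {f = λ i → (i + x , y)} (λ eq → +-cancelʳ-≡ x _ _ (cong proj₁ eq)) (suc n)

  rightward-box : ∀ n → All (Box x (suc n + x) y (suc y)) (rightward x n y)
  rightward-box n = Allₚ.applyUpTo⁺₁ _ (suc n) λ {i} i<sn → (m≤n+m x i , +-monoˡ-< x i<sn) , (≤-refl , ≤-refl)

  leftward-box : ∀ n → All (Box x (suc n + x) y (suc y)) (leftward x n y)
  leftward-box n = Allₚ.applyDownFrom⁺₁ _ (suc n) λ {i} i<sn → (m≤n+m x i , +-monoˡ-< x i<sn) , (≤-refl , ≤-refl)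

  rows-rightward : ∀ n → All (Rows y (suc y)) (rightward x n y)
  rows-rightward n = All.map proj₂ (rightward-box n)

  rows-leftward : ∀ n → All (Rows y (suc y)) (leftward x n y)
  rows-leftward n = All.map proj₂ (leftward-box n)

module _ {x : ℕ} where

  downward-unique : ∀ n → Unique (downward x n)
  downward-unique n = applyDownFrom-unique {f = λ i → (x , i)} (cong proj₂) (suc n)

  downward-box : ∀ n → All (Box x (suc x) 0 (suc n)) (downward x n)
  downward-box n = Allₚ.applyDownFrom⁺₁ _ (suc n) λ i<sn → (≤-refl , ≤-refl) , (z≤n , i<sn)

double-suc : ∀ k y → suc k + suc k + y ≡ suc (suc (k + k + y))
double-suc = solve-∀

+-suc-suc : ∀ k y → k + k + suc (suc y) ≡ suc (suc (k + k + y))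
+-suc-suc = solve-∀

above-box : ∀ x y v → All (Box x (suc x) (suc y) (suc (y + v))) (above x y v)
above-box x y zero    = []
above-box x y (suc v) = ((≤-refl , ≤-refl) , (≤-refl , s≤s (≤-trans (s≤s (m≤m+n y v)) (≤-reflexive (sym (+-suc y v)))))) ∷
  All.map (λ (cols , rows) → cols , Range-mono (n≤1+n _) (≤-reflexive (cong suc (sym (+-suc y v)))) rows)
          (above-box x (suc y) v)

above-unique : ∀ x y v → Unique (above x y v)
above-unique x y zero    = []
above-unique x y (suc v) =
  All.map (λ (_ , (y+2≤ , _)) eq → <-irrefl (cong proj₂ eq) y+2≤) (above-box x (suc y) v) ∷ above-unique x (suc y) v

length-above : ∀ x y v → length (above x y v) ≡ v
length-above x y zero    = refl
length-above x y (suc v) = cong suc (length-above x (suc y) v)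

teeth-rows : ∀ x y es → All (Rows y (length es + length es + y)) (teeth x y es)
teeth-rows x y []       = []
teeth-rows x y (e ∷ es) = ++⁺ (All.map (Range-mono ≤-refl (s≤s (m≤n+m y _))) (rows-rightward e))
  (++⁺ (All.map (Range-mono (n≤1+n y) (subst (suc (suc y) ≤_) (sym (double-suc (length es) y)) (s≤s (s≤s (m≤n+m y _)))))
                (rows-leftward e))
       (All.map (Range-mono (≤-trans (n≤1+n y) (n≤1+n (suc y)))
                            (≤-reflexive (trans (+-suc-suc (length es) y) (sym (double-suc (length es) y)))))
                (teeth-rows x (2 + y) es)))

teeth-cols : ∀ {cap} x y es → All (_≤ cap) es → All (Cols x (suc cap + x)) (teeth x y es)
teeth-cols x y []       []           = []
teeth-cols {cap} x y (e ∷ es) (e≤cap ∷ es≤cap) =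
  ++⁺ (All.map (λ {p} box → widen {p} (proj₁ box)) (rightward-box {x} {y} e))
      (++⁺ (All.map (λ {p} box → widen {p} (proj₁ box)) (leftward-box {x} {suc y} e)) (teeth-cols x (2 + y) es es≤cap))
  where
  widen : ∀ {p} → Cols x (suc e + x) p → Cols x (suc cap + x) p
  widen = Range-mono ≤-refl (+-monoˡ-≤ x (s≤s e≤cap))

teeth-unique : ∀ x y es → Unique (teeth x y es)
teeth-unique x y []       = []
teeth-unique x y (e ∷ es) =
  Unique.++⁺ (rightward-unique e)
    (Unique.++⁺ (leftward-unique e) (teeth-unique x (2 + y) es)
      (All-disjoint (Range-apart ≤-refl) L-rows (teeth-rows x (2 + y) es)))
    (Disjoint-++ʳ (All-disjoint (Range-apart ≤-refl) R-rows L-rows)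
                  (All-disjoint (Range-apart (n≤1+n _)) R-rows (teeth-rows x (2 + y) es)))
  where
  R-rows = rows-rightward {x} {y} e
  L-rows = rows-leftward {x} {suc y} e

length-teeth : ∀ x y es → length (teeth x y es) ≡ length es + length es + (sum es + sum es)
length-teeth x y []       = refl
length-teeth x y (e ∷ es) = begin
  length (rightward x e y ++ₗ leftward x e (suc y) ++ₗ teeth x (2 + y) es)
    ≡⟨ length-++ (rightward x e y) ⟩
  length (rightward x e y) + length (leftward x e (suc y) ++ₗ teeth x (2 + y) es)
    ≡⟨ cong (length (rightward x e y) +_) (length-++ (leftward x e (suc y))) ⟩
  length (rightward x e y) + (length (leftward x e (suc y)) + length (teeth x (2 + y) es))
    ≡⟨ cong₂ (λ r l → r + (l + length (teeth x (2 + y) es))) (length-applyUpTo (λ i → (i + x , y)) (suc e))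
                                                                   (length-applyDownFrom (λ i → (i + x , suc y)) (suc e)) ⟩
  suc e + (suc e + length (teeth x (2 + y) es))
    ≡⟨ cong (λ t → suc e + (suc e + t)) (length-teeth x (2 + y) es) ⟩
  suc e + (suc e + (length es + length es + (sum es + sum es)))
    ≡⟨ rearrange e (length es) (sum es) ⟩
  suc (length es) + suc (length es) + ((e + sum es) + (e + sum es)) ∎
  where
  open ≡-Reasoning
  rearrange : ∀ e k s → suc e + (suc e + (k + k + (s + s))) ≡ suc k + suc k + ((e + s) + (e + s))
  rearrange = solve-∀

module _ {a b : ℕ} where

  rightward-walk : ∀ {x y} n → Walk (Torus a b) (x , y) (n + x , y) (rightward x n y)
  rightward-walk {x} {y} = applyUpTo-walk (λ i → (i + x , y)) (λ _ → fwd right)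

  leftward-walk : ∀ {x y} n → Walk (Torus a b) (n + x , y) (x , y) (leftward x n y)
  leftward-walk {x} {y} = applyDownFrom-walk (λ i → (i + x , y)) (λ _ → bwd right)

  downward-walk : ∀ {x} n → Walk (Torus a b) (x , n) (x , 0) (downward x n)
  downward-walk {x} = applyDownFrom-walk (λ i → (x , i)) (λ _ → bwd up)

  above-walk : ∀ {p x y ps} v → Walk (Torus a b) p (x , y) ps → Walk (Torus a b) p (x , y + v) (ps ++ₗ above x y v)
  above-walk {p} {x} {y} {ps} zero w = subst₂ (Walk _ p) (cong (x ,_) (sym (+-identityʳ y))) (sym (++-identityʳ ps)) w
  above-walk {p} {x} {y} {ps} (suc v) w =
    subst₂ (Walk _ p) (cong (x ,_) (sym (+-suc y v))) (++-assoc ps _ (above x (suc y) v))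
      (above-walk v (Walk-++ w (fwd up) [ (x , suc y) ]))

  teeth-walk : ∀ {p x y ps} es → Walk (Torus a b) p (x , y) ps →
               Walk (Torus a b) p (x , length es + length es + y) (ps ++ₗ teeth x (suc y) es)
  teeth-walk {p} {x} {y} {ps} [] w = subst (Walk _ p (x , y)) (sym (++-identityʳ ps)) w
  teeth-walk {p} {x} {y} {ps} (e ∷ es) w =
    subst₂ (Walk _ p) (cong (x ,_) (trans (+-suc-suc (length es) y) (sym (double-suc (length es) y))))
      (trans (++-assoc (ps ++ₗ rightward x e (suc y)) _ _) (++-assoc ps _ _))
      (teeth-walk es (Walk-++ (Walk-++ w (fwd up) (rightward-walk e)) (fwd up) (leftward-walk e)))

1+c+1≤2+c : ∀ c → suc c + 1 ≤ 2 + c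
1+c+1≤2+c c = ≤-reflexive (cong suc (+-comm c 1))

GridCycle : ℕ → ℕ → ℕ → Set
GridCycle a b ℓ = Σ[ C ∈ Cycle (Torus a b) ℓ ] All (InGrid a b) (Cycle.vertices C)

-- Down the column x = 0, along row 0 from (w + 1 , 0) back to (1 , 0), up v steps in column 1, and
-- through teeth of widths es to the right of column 1. With w = 0 the first step is a plain step to
-- the right; with w = c it wraps around, and the cycle winds once around the first factor.
spineCycle : ∀ {b} c w v es → Torus (2 + c) b (0 , 0) (w + 1 , 0) → w ≤ c → All (_≤ c) es →
             length es + length es + v < b →
             GridCycle (2 + c) b (2 + w + ((v + (length es + length es + sum es)) + (v + (length es + length es + sum es))))
spineCycle c w v es step w≤c es≤c T<b = record
  { start    = (0 , T)
  ; end      = (1 , T)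
  ; vertices = D ++ₗ L ++ₗ A ++ₗ U
  ; walk     = subst (Walk _ (0 , T) (1 , T)) (trans (++-assoc (D ++ₗ L) A U) (++-assoc D L (A ++ₗ U)))
                 (teeth-walk es (above-walk v (Walk-++ (downward-walk T) step (leftward-walk w))))
  ; closing  = bwd right
  ; unique   = Unique.++⁺ (downward-unique T)
                 (Unique.++⁺ (leftward-unique w)
                   (Unique.++⁺ (above-unique 1 0 v) (teeth-unique 1 (suc v) es)
                     (All-disjoint (Range-apart ≤-refl) A-rows U-rows))
                   (Disjoint-++ʳ (All-disjoint (Range-apart ≤-refl) L-rows A-rows)
                                 (All-disjoint (Range-apart (s≤s z≤n)) L-rows U-rows)))
                 (Disjoint-++ʳ (All-disjoint (Range-apart ≤-refl) D-cols L-cols)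
                   (Disjoint-++ʳ (All-disjoint (Range-apart ≤-refl) D-cols A-cols)
                                 (All-disjoint (Range-apart ≤-refl) D-cols U-cols)))
  ; length≡  = begin
      length (D ++ₗ L ++ₗ A ++ₗ U)
        ≡⟨ length-++ D ⟩
      length D + length (L ++ₗ A ++ₗ U)
        ≡⟨ cong (length D +_) (trans (length-++ L) (cong (length L +_) (length-++ A))) ⟩
      length D + (length L + (length A + length U))
        ≡⟨ cong₂ _+_ (length-applyDownFrom (λ i → (0 , i)) (suc T))
             (cong₂ _+_ (length-applyDownFrom (λ i → (i + 1 , 0)) (suc w))
                        (cong₂ _+_ (length-above 1 0 v) (length-teeth 1 (suc v) es))) ⟩
      suc T + (suc w + (v + (k + k + (sum es + sum es))))
        ≡⟨ arithmetic k v w (sum es) ⟩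
      2 + w + ((v + (k + k + sum es)) + (v + (k + k + sum es))) ∎
  } , ++⁺ (All.map (Box⇒InGrid (s≤s z≤n) T<b) (downward-box T))
        (++⁺ (All.map (Box⇒InGrid (≤-trans (+-monoˡ-≤ 1 (s≤s w≤c)) (1+c+1≤2+c c)) (≤-trans (s≤s z≤n) T<b)) (leftward-box w))
          (++⁺ (All.map (Box⇒InGrid (s≤s (s≤s z≤n)) (≤-trans (s≤s (m≤n+m v (k + k))) T<b)) (above-box 1 0 v))
               (All.zipWith (λ (cols , rows) → Box⇒InGrid (1+c+1≤2+c c) (≤-trans (≤-reflexive (+-suc (k + k) v)) T<b)
                                                           (cols , rows))
                            (teeth-cols 1 (suc v) es es≤c , teeth-rows 1 (suc v) es))))
  where
  k = length es
  T = k + k + v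
  D = downward 0 T
  L = leftward 1 w 0
  A = above 1 0 v
  U = teeth 1 (suc v) es
  D-cols = All.map proj₁ (downward-box {0} T)
  L-cols = All.map proj₁ (leftward-box {1} {0} w)
  L-rows = All.map proj₂ (leftward-box {1} {0} w)
  A-cols = All.map proj₁ (above-box 1 0 v)
  A-rows = All.map proj₂ (above-box 1 0 v)
  U-cols = teeth-cols 1 (suc v) es es≤c
  U-rows = teeth-rows 1 (suc v) es
  arithmetic : ∀ k v w E → suc (k + k + v) + (suc w + (v + (k + k + (E + E))))
                           ≡ 2 + w + ((v + (k + k + E)) + (v + (k + k + E)))
  arithmetic = solve-∀
  open ≡-Reasoning

-- A hairpin of width w + 1 in rows 0 and 1, all of row 2 ending with the horizontal wrap, teeth of
-- widths es above, and the vertical wrap back to (0 , 0): the cycle winds once in each direction.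
torusCycle : ∀ c w es → w ≤ c → All (_≤ suc c) es →
             GridCycle (2 + c) (length es + length es + 3)
                       ((2 + c) + (length es + length es + 3) + ((w + sum es) + (w + sum es)))
torusCycle c w es w≤c es≤ = record
  { start    = (0 , 0)
  ; end      = (0 , k + k + 2)
  ; vertices = R₁ ++ₗ R₂ ++ₗ R₃ ++ₗ P ++ₗ U
  ; walk     = subst (Walk _ (0 , 0) (0 , k + k + 2))
                 (trans (++-assoc ((R₁ ++ₗ R₂) ++ₗ R₃) P U) (trans (++-assoc (R₁ ++ₗ R₂) R₃ (P ++ₗ U)) (++-assoc R₁ R₂ _)))
                 (teeth-walk es
                   (Walk-++ (Walk-++ (Walk-++ (rightward-walk (suc w)) hairpin (leftward-walk w))
                                     (fwd up) (rightward-walk c))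
                            (fwd (wrapʳ (cong suc (+-comm c 1)))) [ (0 , 2) ]))
  ; closing  = fwd (wrapᵘ (sym (+-suc (k + k) 2)))
  ; unique   = Unique.++⁺ (rightward-unique (suc w))
                 (Unique.++⁺ (leftward-unique w)
                   (Unique.++⁺ (rightward-unique c)
                     (Unique.++⁺ ([] ∷ []) (teeth-unique 0 3 es) (All-disjoint (Range-apart ≤-refl) P-rows U-rows))
                     (Disjoint-++ʳ (All-disjoint (λ r p → Range-apart ≤-refl p r) R₃-cols P-cols)
                                   (All-disjoint (Range-apart ≤-refl) R₃-rows U-rows)))
                   (All-disjoint (Range-apart ≤-refl) R₂-rows R₃PU-rows))
                 (All-disjoint (Range-apart ≤-refl) R₁-rows R₂R₃PU-rows)
  ; length≡  = begin
      length (R₁ ++ₗ R₂ ++ₗ R₃ ++ₗ P ++ₗ U)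
        ≡⟨ length-++ R₁ ⟩
      length R₁ + length (R₂ ++ₗ R₃ ++ₗ P ++ₗ U)
        ≡⟨ cong (length R₁ +_) (trans (length-++ R₂) (cong (length R₂ +_) (length-++ R₃))) ⟩
      length R₁ + (length R₂ + (length R₃ + suc (length U)))
        ≡⟨ cong₂ _+_ (length-applyUpTo (λ i → (i + 0 , 0)) (suc (suc w)))
             (cong₂ _+_ (length-applyDownFrom (λ i → (i + 1 , 1)) (suc w))
               (cong₂ (λ r u → r + suc u) (length-applyUpTo (λ i → (i + 1 , 2)) (suc c)) (length-teeth 0 3 es))) ⟩
      suc (suc w) + (suc w + (suc c + suc (k + k + (sum es + sum es))))
        ≡⟨ arithmetic c k w (sum es) ⟩
      (2 + c) + (k + k + 3) + ((w + sum es) + (w + sum es)) ∎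
  } , ++⁺ (All.map (Box⇒InGrid (s≤s (s≤s (≤-trans (≤-reflexive (+-identityʳ w)) w≤c))) (≤-trans (s≤s z≤n) 3≤b))
                   (rightward-box {0} {0} (suc w)))
        (++⁺ (All.map (Box⇒InGrid (≤-trans (+-monoˡ-≤ 1 (s≤s w≤c)) (1+c+1≤2+c c)) (≤-trans (s≤s (s≤s z≤n)) 3≤b))
                      (leftward-box {1} {1} w))
          (++⁺ (All.map (Box⇒InGrid (1+c+1≤2+c c) 3≤b) (rightward-box {1} {2} c))
            (++⁺ (All.map (Box⇒InGrid (s≤s z≤n) 3≤b) (All.zip (P-cols , P-rows)))
                 (All.zipWith (λ (cols , rows) → Box⇒InGrid (≤-reflexive (+-identityʳ (2 + c))) ≤-refl (cols , rows))
                              (teeth-cols 0 3 es es≤ , U-rows)))))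
  where
  open ≡-Reasoning
  arithmetic : ∀ c k w E → suc (suc w) + (suc w + (suc c + suc (k + k + (E + E))))
                           ≡ (2 + c) + (k + k + 3) + ((w + E) + (w + E))
  arithmetic = solve-∀
  k = length es
  R₁ = rightward 0 (suc w) 0
  R₂ = leftward 1 w 1
  R₃ = rightward 1 c 2
  P  = (0 , 2) ∷ []
  U  = teeth 0 3 es
  hairpin : Torus (2 + c) (k + k + 3) (suc w + 0 , 0) (w + 1 , 1)
  hairpin = subst (λ x → Torus (2 + c) (k + k + 3) (suc w + 0 , 0) (x , 1))
                  (trans (+-identityʳ (suc w)) (+-comm 1 w)) (fwd up)
  R₁-rows = All.map proj₂ (rightward-box {0} {0} (suc w))
  R₂-rows = All.map proj₂ (leftward-box {1} {1} w)
  R₃-rows = All.map proj₂ (rightward-box {1} {2} c)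
  R₃-cols = All.map proj₁ (rightward-box {1} {2} c)
  P-rows : All (Rows 2 3) P
  P-rows = (≤-refl , ≤-refl) ∷ []
  P-cols : All (Cols 0 1) P
  P-cols = (z≤n , ≤-refl) ∷ []
  U-rows = teeth-rows 0 3 es
  3≤b : 3 ≤ k + k + 3
  3≤b = m≤n+m 3 (k + k)
  R₃PU-rows : All (Rows 2 (k + k + 3)) (R₃ ++ₗ P ++ₗ U)
  R₃PU-rows = ++⁺ (All.map (Range-mono ≤-refl 3≤b) R₃-rows)
                  (++⁺ (All.map (Range-mono ≤-refl 3≤b) P-rows) (All.map (Range-mono (n≤1+n 2) ≤-refl) U-rows))
  R₂R₃PU-rows : All (Rows 1 (k + k + 3)) (R₂ ++ₗ R₃ ++ₗ P ++ₗ U)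
  R₂R₃PU-rows = ++⁺ (All.map (Range-mono ≤-refl (≤-trans (n≤1+n 2) 3≤b)) R₂-rows)
                    (All.map (Range-mono (n≤1+n 1) ≤-refl) R₃PU-rows)

composition : ∀ k cap E → E ≤ k * cap → Σ[ es ∈ List ℕ ] (length es ≡ k × All (_≤ cap) es × sum es ≡ E)
composition zero    cap E E≤0 = [] , refl , [] , sym (n≤0⇒n≡0 E≤0)
composition (suc k) cap E E≤ with E ≤? cap
... | yes E≤cap with composition k cap 0 z≤n
...   | es , refl , es≤ , sum≡0 = E ∷ es , refl , E≤cap ∷ es≤ , trans (cong (E +_) sum≡0) (+-identityʳ E)
composition (suc k) cap E E≤ | no E≰cap
  with composition k cap (E ∸ cap) (≤-trans (∸-monoˡ-≤ cap E≤) (≤-reflexive (m+n∸m≡n cap (k * cap))))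
... | es , refl , es≤ , sum≡ = cap ∷ es , refl , ≤-refl ∷ es≤ , trans (cong (cap +_) sum≡) (m+[n∸m]≡n (<⇒≤ (≰⇒> E≰cap)))

2q+E≤[2+c]q⇒E≤qc : ∀ q c E → q + q + E ≤ (2 + c) * q → E ≤ q * c
2q+E≤[2+c]q⇒E≤qc q c E ≤[2+c]q =
  subst (E ≤_) (*-comm c q) (+-cancelˡ-≤ (q + q) E _ (subst (q + q + E ≤_) (sym (+-assoc q q (c * q))) ≤[2+c]q))

spineCycles : ∀ {b} c w q h → Torus (2 + c) b (0 , 0) (w + 1 , 0) → w ≤ c → q + q < b → h ≤ (2 + c) * q →
              GridCycle (2 + c) b (2 + w + (h + h))
spineCycles {b} c w q h step w≤c 2q<b h≤ with h ≤? q + q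
... | yes h≤2q = subst (GridCycle _ _) (cong (λ n → 2 + w + (n + n)) (+-identityʳ h))
                   (spineCycle c w h [] step w≤c [] (≤-<-trans h≤2q 2q<b))
... | no h≰2q with m≤n⇒∃[o]m+o≡n (<⇒≤ (≰⇒> h≰2q))
...   | E , refl with composition q c E (2q+E≤[2+c]q⇒E≤qc q c E h≤)
...     | es , refl , es≤c , refl =
  spineCycle c w 0 es step w≤c es≤c (subst (_< b) (sym (+-identityʳ (length es + length es))) 2q<b)

torusCycles : ∀ c k g → g ≤ c + k * suc c → GridCycle (2 + c) (k + k + 3) ((2 + c) + (k + k + 3) + (g + g))
torusCycles c k g g≤ with g ≤? c
... | yes g≤c with composition k (suc c) 0 z≤n
...   | es , refl , es≤ , sum≡0 =
  subst (GridCycle _ _) (cong (λ n → 2 + c + (length es + length es + 3) + (n + n))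
                              (trans (cong (g +_) sum≡0) (+-identityʳ g)))
    (torusCycle c g es g≤c es≤)
torusCycles c k g g≤ | no g≰c with m≤n⇒∃[o]m+o≡n (<⇒≤ (≰⇒> g≰c))
... | E , refl with composition k (suc c) E (+-cancelˡ-≤ c E _ g≤)
...   | es , refl , es≤ , refl = torusCycle c c es ≤-refl es≤

double-≤-suc : ∀ {m n} → m + m ≤ suc (n + n) → m ≤ n
double-≤-suc {m} {n} m+m≤ with m ≤? n
... | yes m≤n = m≤n
... | no m≰n = ⊥-elim (<-irrefl refl (<-≤-trans (≤-reflexive (sym (+-suc (suc n) n))) (≤-trans (+-mono-≤ n<m n<m) m+m≤)))
  where n<m = ≰⇒> m≰n

double-≤ : ∀ {m n} → m + m ≤ n + n → m ≤ n
double-≤ m+m≤ = double-≤-suc (≤-trans m+m≤ (n≤1+n _))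

module _ (p q : ℕ) where

  private
    P Q a b c X : ℕ
    P = suc p
    Q = suc q
    a = suc (P + P)
    b = suc (Q + Q)
    c = p + suc p
    X = P + a * Q

    a*b≡ : a * b ≡ suc (X + X)
    a*b≡ = lemma p q
      where
      lemma : ∀ p q → suc (suc p + suc p) * suc (suc q + suc q)
                      ≡ suc ((suc p + suc (suc p + suc p) * suc q) + (suc p + suc (suc p + suc p) * suc q))
      lemma = solve-∀

    a*Q≡ : a * Q ≡ suc (Q + (c + q * suc c))
    a*Q≡ = lemma p q
      where
      lemma : ∀ p q → suc (suc p + suc p) * suc q ≡ suc (suc q + ((p + suc p) + q * suc (p + suc p)))
      lemma = solve-∀

    P+Q≤a*Q : P + Q ≤ a * Q
    P+Q≤a*Q = ≤-trans (≤-reflexive (+-comm P Q)) (+-monoʳ-≤ Q (≤-trans (m≤m+n P P) (m≤m*n (P + P) Q)))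

    wrap : Torus a b (0 , 0) (c + 1 , 0)
    wrap = bwd (wrapʳ (cong suc (+-comm c 1)))

    oddCycles : ∀ m → P ≤ m → m ≤ X → GridCycle a b (suc (m + m))
    oddCycles m P≤m m≤X with m≤n⇒∃[o]m+o≡n P≤m
    ... | h , refl =
      subst (GridCycle a b) (length≡ p h) (spineCycles c c Q h wrap ≤-refl ≤-refl (+-cancelˡ-≤ P h (a * Q) m≤X))
      where
      length≡ : ∀ p h → 2 + (p + suc p) + (h + h) ≡ suc ((suc p + h) + (suc p + h))
      length≡ = solve-∀

    evenCycles : ∀ m → a < m + m → m ≤ X → GridCycle a b (m + m)
    evenCycles zero    () _
    evenCycles (suc h) _ 1+h≤X with h ≤? a * Q
    ... | yes h≤ = subst (GridCycle a b) (cong suc (sym (+-suc h h))) (spineCycles c 0 Q h (fwd right) z≤n ≤-refl h≤)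
    ... | no h≰ with m≤n⇒∃[o]m+o≡n (≤-trans P+Q≤a*Q (<⇒≤ (≰⇒> h≰)))
    ...   | g , refl = subst₂ (GridCycle a) (b≡ q) (length≡ p q g) (torusCycles c q g g≤)
      where
      b≡ : ∀ q → q + q + 3 ≡ suc (suc q + suc q)
      b≡ = solve-∀
      length≡ : ∀ p q g → 2 + (p + suc p) + (q + q + 3) + (g + g) ≡ suc (suc p + suc q + g) + suc (suc p + suc q + g)
      length≡ = solve-∀
      g≤ : g ≤ c + q * suc c
      g≤ = +-cancelˡ-≤ Q g _ (≤-pred (subst (suc (Q + g) ≤_) a*Q≡ (+-cancelˡ-≤ P _ _
             (subst (_≤ X) (trans (cong suc (+-assoc P Q g)) (sym (+-suc P (Q + g)))) 1+h≤X))))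

  -- Since a * b = 2X + 1, odd lengths a + 2h have h ≤ a * Q and are winding spine cycles; even
  -- lengths 2 + 2h are non-winding spine cycles while h ≤ a * Q, and torus cycles beyond.
  gridCycles : ∀ ℓ → a < ℓ → ℓ ≤ a * b → GridCycle a b ℓ
  gridCycles ℓ a<ℓ ℓ≤ab with even-or-odd ℓ
  ... | m , inj₂ refl = oddCycles m (double-≤ (<⇒≤ (≤-pred a<ℓ))) (double-≤ (≤-pred (subst (suc (m + m) ≤_) a*b≡ ℓ≤ab)))
  ... | m , inj₁ refl = evenCycles m a<ℓ (double-≤-suc (subst (m + m ≤_) a*b≡ ℓ≤ab))

-- Cycles of ε(G₁ ∪ᴳ G₂)

module Periodic {n} {G : Graph n} {k} (C : TARSCycle G k) where

  open TARSCycle C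

  -- Reading the cycle periodically makes the closing move just another step: at-step holds for every x.
  at : ℕ → Subset n
  at x = c (x mod suc k)

  private
    c-cong : ∀ {i j} → toℕ i ≡ toℕ j → c i ≡ c j
    c-cong = cong c ∘ toℕ-injective

    toℕ-mod : ∀ x → toℕ (x mod suc k) ≡ x % suc k
    toℕ-mod x = toℕ-fromℕ< (m%n<n x (suc k))

    suc-% : ∀ x → suc x % suc k ≡ suc (x % suc k) % suc k
    suc-% x = trans (cong (λ y → suc y % suc k) (m≡m%n+[m/n]*n x (suc k))) ([m+kn]%n≡m%n (suc (x % suc k)) (x / suc k) (suc k))

  at-step : ∀ x → TARSAdj G (at x) (at (suc x))
  at-step x with x % suc k <? k
  ... | yes r<k = subst₂ (TARSAdj G)
        (c-cong (trans (toℕ-inject₁ i) (trans (toℕ-fromℕ< r<k) (sym (toℕ-mod x)))))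
        (c-cong (trans (cong suc (toℕ-fromℕ< r<k)) (sym (trans (toℕ-mod (suc x)) (trans (suc-% x) (m<n⇒m%n≡m (s≤s r<k)))))))
        (step i)
    where i = fromℕ< r<k
  ... | no r≮k = subst₂ (TARSAdj G)
        (c-cong (trans (toℕ-fromℕ k) (sym (trans (toℕ-mod x) r≡k))))
        (c-cong (sym (trans (toℕ-mod (suc x)) (trans (suc-% x) (trans (cong (λ r → suc r % suc k) r≡k) (n%n≡0 (suc k)))))))
        close
    where r≡k = ≤-antisym (≤-pred (m%n<n x (suc k))) (≮⇒≥ r≮k)

  at-period : at (suc k) ≡ at 0
  at-period = c-cong (trans (toℕ-mod (suc k)) (n%n≡0 (suc k)))

  at-injective : ∀ {x y} → x < suc k → y < suc k → at x ≡ at y → x ≡ y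
  at-injective x< y< eq = trans (sym (toℕ-mod-< x<)) (trans (cong toℕ (inj eq)) (toℕ-mod-< y<))
    where
    toℕ-mod-< : ∀ {z} → z < suc k → toℕ (z mod suc k) ≡ z
    toℕ-mod-< {z} z< = trans (toℕ-mod z) (m<n⇒m%n≡m z<)

⊤-dominating : (G : Graph n) → Dominating G ⊤
⊤-dominating G v v∉⊤ = ⊥-elim (v∉⊤ ∈⊤)

hamiltonianCycle : ∀ {G : Graph n} {p} → TARSPancyclic G → numDom G ≡ suc (suc p + suc p) → TARSCycle G (suc p + suc p)
hamiltonianCycle {p = p} pancyclic N≡ = pancyclic _ (s≤s (s≤s (≤-trans (s≤s z≤n) (m≤n+m (suc p) p)))) (≤-reflexive (sym N≡))

factor≢1 : ∀ {l m n} → n < l → l ≤ m * n → m ≢ 1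
factor≢1 {l} {n = n} n<l l≤m*n refl = <-irrefl refl (<-≤-trans n<l (subst (l ≤_) (+-identityʳ n) l≤m*n))

module _ {n₁ n₂} {G₁ : Graph n₁} {G₂ : Graph n₂} where

  open Union G₁ G₂

  TARSCycle-++ˡ : ∀ {k} → TARSCycle G₁ k → TARSCycle H k
  TARSCycle-++ˡ C = record
    { c     = λ i → c i ++ ⊤
    ; dom   = λ i → Dominating-++⁺ (dom i) (⊤-dominating G₂)
    ; inj   = λ eq → inj (++-injectiveˡ _ _ eq)
    ; step  = λ i → TARSAdj-++ˡ ⊤ (step i)
    ; close = TARSAdj-++ˡ ⊤ close
    }
    where open TARSCycle C

  TARSCycle-++ʳ : ∀ {k} → TARSCycle G₂ k → TARSCycle H k
  TARSCycle-++ʳ C = record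
    { c     = λ i → ⊤ ++ c i
    ; dom   = λ i → Dominating-++⁺ (⊤-dominating G₁) (dom i)
    ; inj   = λ eq → inj (++-injectiveʳ ⊤ ⊤ eq)
    ; step  = λ i → TARSAdj-++ʳ ⊤ (step i)
    ; close = TARSAdj-++ʳ ⊤ close
    }
    where open TARSCycle C

  TARSCycle-product : ∀ {k₁ k₂ k} → TARSCycle G₁ k₁ → TARSCycle G₂ k₂ → GridCycle (suc k₁) (suc k₂) (suc k) → TARSCycle H k
  TARSCycle-product {k₁} {k₂} C₁ C₂ (C , inGrid) =
    Cycle→TARSCycle H (Cycle-map φ φ-hom φ-injective C inGrid)
      (map⁺ (All.universal (λ _ → Dominating-++⁺ (TARSCycle.dom C₁ _) (TARSCycle.dom C₂ _)) (Cycle.vertices C)))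
    where
    open Periodic C₁ using () renaming (at to X; at-step to X-step; at-period to X-period; at-injective to X-injective)
    open Periodic C₂ using () renaming (at to Y; at-step to Y-step; at-period to Y-period; at-injective to Y-injective)

    φ : Point → Subset (n₁ + n₂)
    φ (x , y) = X x ++ Y y

    φ-move : ∀ {p q} → Move (suc k₁) (suc k₂) p q → TARSAdj H (φ p) (φ q)
    φ-move {x , y} right       = TARSAdj-++ˡ (Y y) (X-step x)
    φ-move {x , y} up          = TARSAdj-++ʳ (X x) (Y-step y)
    φ-move {x , y} (wrapʳ refl) = subst (λ S → TARSAdj H (X x ++ Y y) (S ++ Y y)) X-period (TARSAdj-++ˡ (Y y) (X-step x))
    φ-move {x , y} (wrapᵘ refl) = subst (λ S → TARSAdj H (X x ++ Y y) (X x ++ S)) Y-period (TARSAdj-++ʳ (X x) (Y-step y))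

    φ-hom : ∀ {p q} → Torus (suc k₁) (suc k₂) p q → TARSAdj H (φ p) (φ q)
    φ-hom (fwd move) = φ-move move
    φ-hom (bwd move) = TARSAdj-sym H (φ-move move)

    φ-injective : ∀ {p q} → InGrid (suc k₁) (suc k₂) p → InGrid (suc k₁) (suc k₂) q → φ p ≡ φ q → p ≡ q
    φ-injective ((_ , x<) , (_ , y<)) ((_ , x′<) , (_ , y′<)) eq =
      cong₂ _,_ (X-injective x< x′< (++-injectiveˡ _ _ eq)) (Y-injective y< y′< (++-injectiveʳ _ _ eq))

  longCycles : ∀ {k} → TARSPancyclic G₁ → TARSPancyclic G₂ → numDom G₁ < suc k → numDom G₂ < suc k →
               suc k ≤ numDom H → TARSCycle H k
  longCycles {k} pan₁ pan₂ N₁< N₂< ℓ≤N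
    with subst (suc k ≤_) numDom-∪ᴳ ℓ≤N | odd-witness (Brouwer.numDom-odd G₁) | odd-witness (Brouwer.numDom-odd G₂)
  ... | ℓ≤N₁*N₂ | zero  , N₁≡1 | _           = ⊥-elim (factor≢1 N₂< ℓ≤N₁*N₂ N₁≡1)
  ... | ℓ≤N₁*N₂ | suc _ , _    | zero , N₂≡1 = ⊥-elim (factor≢1 N₁< (subst (suc k ≤_) (*-comm (numDom G₁) _) ℓ≤N₁*N₂) N₂≡1)
  ... | ℓ≤N₁*N₂ | suc p , N₁≡  | suc q , N₂≡ =
    TARSCycle-product (hamiltonianCycle pan₁ N₁≡) (hamiltonianCycle pan₂ N₂≡)
      (gridCycles p q (suc k) (subst (_< suc k) N₁≡ N₁<) (subst (suc k ≤_) (cong₂ _*_ N₁≡ N₂≡) ℓ≤N₁*N₂))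

mainTheorem5 : ∀ {n₁ n₂ : ℕ} (H₁ : Graph n₁) (H₂ : Graph n₂) →
               TARSPancyclic H₁ → TARSPancyclic H₂ → TARSPancyclic (H₁ ∪ᴳ H₂)
mainTheorem5 H₁ H₂ pan₁ pan₂ k 3≤ℓ ℓ≤N with suc k ≤? numDom H₁ | suc k ≤? numDom H₂
... | yes ℓ≤N₁ | _        = TARSCycle-++ˡ (pan₁ k 3≤ℓ ℓ≤N₁)
... | no _     | yes ℓ≤N₂ = TARSCycle-++ʳ (pan₂ k 3≤ℓ ℓ≤N₂)
... | no ℓ≰N₁  | no ℓ≰N₂  = longCycles pan₁ pan₂ (≰⇒> ℓ≰N₁) (≰⇒> ℓ≰N₂) ℓ≤N
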